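{- Let $G$ be a connected simple graph with $n\ge3$ vertices and $2n-3$ edges, and let $c:E(G)\to[n-1]$ be a colouring with $|c^{ -1}(1)|=1$ and $|c^{ -1}(i)|=2$ for $i=2,\dots,n-1$, such that $G$ has no rainbow cycle. Let $e_1$ be the unique edge of colour $1$. Let $u,v\in V(G)$ with $\{u,v\}$ not equal to the set of endvertices of $e_1$. Then there are two edge-disjoint rainbow paths $P_1,P_2$ from $u$ to $v$ with $|P_1|+|P_2|\le n$.
   Context: A path is rainbow if its edges have pairwise distinct colours; $|P|$ is the number of edges of $P$. -}

module Defs where

open import Data.Nat using (ℕ; zero; suc; _+_; _*_; _∸_; _≤_)
open import Data.Fin using (Fin; toℕ)
open import Data.Fin.Properties using (_≟_)
open import Data.List using (List; []; _∷_; length; map; filter)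
open import Data.List.Base using (allFin)
open import Data.List.Relation.Unary.Unique.Propositional using (Unique)
open import Data.List.Membership.Propositional using (_∈_)
open import Data.Product using (Σ; ∃; _×_; _,_)
open import Data.Sum using (_⊎_)
open import Data.Empty using (⊥)
open import Relation.Nullary using (¬_)
open import Relation.Binary.PropositionalEquality using (_≡_; _≢_)

-- A finite simple graph on vertex set Fin n with edge set Fin m;
-- edge e has endpoints src e and tgt e (unordered).
record Graph (n m : ℕ) : Set where
  field
    src tgt  : Fin m → Fin n
    loopless : ∀ e → src e ≢ tgt e
    simple   : ∀ e f → ((src e ≡ src f × tgt e ≡ tgt f) ⊎ (src e ≡ tgt f × tgt e ≡ src f)) → e ≡ f
open Graph public

module _ {n m : ℕ} (G : Graph n m) where

  Joins : Fin m → Fin n → Fin n → Set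
  Joins e x y = (src G e ≡ x × tgt G e ≡ y) ⊎ (src G e ≡ y × tgt G e ≡ x)

  data Walk : Fin n → Fin n → List (Fin m) → Set where
    [] : ∀ {x} → Walk x x []
    step : ∀ {x y z e es} → Joins e x y → Walk y z es → Walk x z (e ∷ es)

  verts : ∀ {x y es} → Walk x y es → List (Fin n)
  verts {x} [] = x ∷ []
  verts {x} (step _ w) = x ∷ verts w

  tailVerts : ∀ {x y es} → Walk x y es → List (Fin n)
  tailVerts [] = []
  tailVerts (step _ w) = verts w

  IsPath : ∀ {x y es} → Walk x y es → Set
  IsPath w = Unique (verts w)

  IsCycle : ∀ {x es} → Walk x x es → Set
  IsCycle {es = es} w = 3 ≤ length es × Unique es × Unique (tailVerts w)

  Connected : Set
  Connected = ∀ x y → ∃ λ es → Walk x y es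

Rainbow : ∀ {m k} → (Fin m → Fin k) → List (Fin m) → Set
Rainbow c es = Unique (map c es)

EdgeDisjoint : ∀ {m} → List (Fin m) → List (Fin m) → Set
EdgeDisjoint es fs = ∀ e → e ∈ es → e ∈ fs → ⊥

colourCount : ∀ {m k} → (Fin m → Fin k) → Fin k → ℕ
colourCount {m} c i = length (filter (λ e → c e ≟ i) (allFin m))

NoRainbowCycle : ∀ {n m k} → Graph n m → (Fin m → Fin k) → Set
NoRainbowCycle {n} {m} G c =
  ∀ (x : Fin n) (es : List (Fin m)) (w : Walk G x x es) → IsCycle G w → Rainbow c es → ⊥

{-# OPTIONS --safe #-}
-- Let e₁ = xy be the edge of the first colour (index zero). Every inner vertex w ∉ {x, y} owns a
-- colour i ≠ 0, i.e. all edges of colour i are incident with w: otherwise one edge of each colour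
-- avoiding w gives n - 1 edges on the other n - 1 vertices, hence a cycle, and that cycle is rainbow.
-- As G is simple, distinct vertices own distinct colours. Orient every edge of an owned colour away
-- from its owner: each inner vertex gets two out-edges, and a directed cycle would be rainbow, so a
-- set D of vertices closed under out-neighbours and containing an inner vertex has a source.
-- Removing a source w, we prove by induction on |D| three Menger-type statements about rainbow paths
-- inside D: two disjoint paths joining {a, b} to {s, t}; two paths from v to a and to b meeting only
-- at v; and, unless {u, v} = {x, y}, two edge-disjoint u-v paths meeting only at u and v. New paths
-- leave w along its out-edges and stay rainbow, as every edge of the colour of w is incident with w.
-- Two u-v paths meeting only at u and v visit at most n vertices in total, so |P₁| + |P₂| ≤ n.

module Submission where

open import Defs
open import Data.Bool using (Bool; true; false; not)
open import Data.Empty using (⊥; ⊥-elim)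
open import Data.Fin using (Fin; zero; suc; toℕ)
open import Data.Fin.Properties using (_≟_; toℕ-injective)
open import Data.List using (List; []; _∷_; length; map; filter; allFin; reverse; _ʳ++_; _++_; _∷ʳ_)
open import Data.List.Properties using (filter-notAll; length-++; length-tabulate; length-map)
open import Data.List.Membership.Propositional using (_∈_; _∉_; find; lose)
open import Data.List.Membership.Propositional.Properties using (∈-allFin; ∈-filter⁺; ∈-filter⁻; ∈-++⁺ˡ; ∈-map⁻)
open import Data.List.Relation.Binary.Disjoint.Propositional using (Disjoint)
open import Data.List.Relation.Binary.Permutation.Propositional using (_↭_; ↭-sym; ↭⇒↭ₛ)
open import Data.List.Relation.Binary.Permutation.Propositional.Properties as Permutation using (↭-reverse; ∷↭∷ʳ; ∈-resp-↭)
import Data.List.Relation.Binary.Permutation.Setoid.Properties as Permutationₛ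
open import Data.List.Relation.Binary.Subset.Propositional using (_⊆_)
open import Data.List.Relation.Unary.All as All using (All; []; _∷_)
open import Data.List.Relation.Unary.All.Properties using (¬Any⇒All¬; ¬All⇒Any¬)
open import Data.List.Relation.Unary.Any using (here; there; any?; satisfied)
open import Data.List.Relation.Unary.Unique.Propositional using (Unique; []; _∷_)
open import Data.List.Relation.Unary.Unique.Propositional.Properties using (allFin⁺; filter⁺; ++⁺; map⁺; map⁻; Unique[x∷xs]⇒x∉xs)
open import Data.Nat using (ℕ; zero; suc; _+_; _*_; _∸_; _≤_; _<_; z≤n; s≤s; _≤?_)
open import Data.Nat.Properties using (≤-trans; ≤-refl; ≤-reflexive; <⇒≱; ≰⇒>; +-suc; m<m+n; +-monoˡ-≤; ≤-pred; module ≤-Reasoning)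
open import Data.Product using (Σ; ∃; ∃₂; _×_; _,_; proj₁; proj₂)
open import Data.Unit using (⊤; tt)
open import Data.Sum as Sum using (_⊎_; inj₁; inj₂)
open import Function using (_∘_; case_of_)
open import Relation.Binary.Definitions using (DecidableEquality)
open import Relation.Binary.PropositionalEquality using (_≡_; _≢_; refl; sym; trans; cong; cong₂; subst; setoid)
open import Relation.Nullary using (¬_; Dec; yes; no; ¬?)
open import Relation.Nullary.Decidable using (_×-dec_; _⊎-dec_; decidable-stable; map′)

Unique-∷ : {A : Set} {x : A} {xs : List A} → x ∉ xs → Unique xs → Unique (x ∷ xs)
Unique-∷ {xs = xs} x∉xs u = ¬Any⇒All¬ xs x∉xs ∷ u

Unique-↭ : {A : Set} {xs ys : List A} → xs ↭ ys → Unique xs → Unique ys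
Unique-↭ {A = A} xs↭ys = Permutationₛ.Unique-resp-↭ (setoid A) (↭⇒↭ₛ xs↭ys)

Unique-∷ʳ⇒∷ : {A : Set} {x : A} (xs : List A) → Unique (xs ∷ʳ x) → Unique (x ∷ xs)
Unique-∷ʳ⇒∷ {x = x} xs = Unique-↭ (↭-sym (∷↭∷ʳ x xs))

Unique-map-injectiveOn : {A B : Set} {f : A → B} {xs : List A} →
                         (∀ {a b} → a ∈ xs → b ∈ xs → f a ≡ f b → a ≡ b) → Unique xs → Unique (map f xs)
Unique-map-injectiveOn inj [] = []
Unique-map-injectiveOn {f = f} inj (a∉as ∷ u) =
  Unique-∷ (λ fa∈ → let _ , b∈as , fa≡fb = ∈-map⁻ f fa∈
                    in All.lookup a∉as b∈as (inj (here refl) (there b∈as) fa≡fb))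
           (Unique-map-injectiveOn (λ a∈ b∈ → inj (there a∈) (there b∈)) u)

Unique⇒length≤ : {A : Set} {xs ys : List A} → DecidableEquality A → Unique xs → xs ⊆ ys → length xs ≤ length ys
Unique⇒length≤ _≟ᴬ_ [] _ = z≤n
Unique⇒length≤ {xs = x ∷ xs} {ys = ys} _≟ᴬ_ (x∉xs ∷ u) x∷xs⊆ys =
  ≤-trans (s≤s (Unique⇒length≤ _≟ᴬ_ u xs⊆ys-x))
          (filter-notAll other? ys (lose (x∷xs⊆ys (here refl)) λ x≢x → x≢x refl))
  where
  other? : ∀ y → Dec (y ≢ x)
  other? y = ¬? (y ≟ᴬ x)
  xs⊆ys-x : xs ⊆ filter other? ys
  xs⊆ys-x y∈xs = ∈-filter⁺ other? (x∷xs⊆ys (there y∈xs)) λ { refl → All.lookup x∉xs y∈xs refl }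

Unique-Fin⇒length≤ : ∀ {n} {xs : List (Fin n)} → Unique xs → length xs ≤ n
Unique-Fin⇒length≤ {n} {xs} u =
  subst (length xs ≤_) (length-tabulate {n = n} (λ i → i)) (Unique⇒length≤ _≟_ u (λ {i} _ → ∈-allFin i))

twoDistinct : {A : Set} {xs : List A} → Unique xs → 2 ≤ length xs → ∃₂ λ a b → a ≢ b × a ∈ xs × b ∈ xs
twoDistinct {xs = a ∷ b ∷ _} ((a≢b ∷ _) ∷ _) _        = a , b , a≢b , here refl , there (here refl)
twoDistinct {xs = _ ∷ []}    _                 (s≤s ())

∈⇒0<length : {A : Set} {x : A} {xs : List A} → x ∈ xs → 0 < length xs
∈⇒0<length (here _)  = s≤s z≤n
∈⇒0<length (there _) = s≤s z≤n

length-filter+∁ : {A : Set} {P : A → Set} (P? : ∀ x → Dec (P x)) (xs : List A) →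
                  length (filter P? xs) + length (filter (λ x → ¬? (P? x)) xs) ≡ length xs
length-filter+∁ P? []       = refl
length-filter+∁ P? (x ∷ xs) with P? x
... | yes _ = cong suc (length-filter+∁ P? xs)
... | no _  = trans (+-suc _ _) (cong suc (length-filter+∁ P? xs))

module Walks {n m : ℕ} (G : Graph n m) where

  V : Set
  V = Fin n

  Touches : Fin m → V → Set
  Touches e z = src G e ≡ z ⊎ tgt G e ≡ z

  touches? : ∀ e z → Dec (Touches e z)
  touches? e z with src G e ≟ z | tgt G e ≟ z
  ... | yes s≡z | _       = yes (inj₁ s≡z)
  ... | no _    | yes t≡z = yes (inj₂ t≡z)
  ... | no s≢z  | no t≢z  = no λ { (inj₁ s≡z) → s≢z s≡z ; (inj₂ t≡z) → t≢z t≡z }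

  joins? : ∀ e a b → Dec (Joins G e a b)
  joins? e a b = (src G e ≟ a ×-dec tgt G e ≟ b) ⊎-dec (src G e ≟ b ×-dec tgt G e ≟ a)

  Joins-sym : ∀ {e a b} → Joins G e a b → Joins G e b a
  Joins-sym (inj₁ (s≡a , t≡b)) = inj₂ (s≡a , t≡b)
  Joins-sym (inj₂ (s≡b , t≡a)) = inj₁ (s≡b , t≡a)

  Joins⇒Touches : ∀ {e a b} → Joins G e a b → Touches e a
  Joins⇒Touches (inj₁ (s≡a , _)) = inj₁ s≡a
  Joins⇒Touches (inj₂ (_ , t≡a)) = inj₂ t≡a

  Joins-irrefl : ∀ {e a} → ¬ Joins G e a a
  Joins-irrefl (inj₁ (s≡a , t≡a)) = loopless G _ (trans s≡a (sym t≡a))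
  Joins-irrefl (inj₂ (s≡a , t≡a)) = loopless G _ (trans s≡a (sym t≡a))

  Joins-unique : ∀ {e f a b} → Joins G e a b → Joins G f a b → e ≡ f
  Joins-unique (inj₁ (p , q)) (inj₁ (r , s)) = simple G _ _ (inj₁ (trans p (sym r) , trans q (sym s)))
  Joins-unique (inj₁ (p , q)) (inj₂ (r , s)) = simple G _ _ (inj₂ (trans p (sym s) , trans q (sym r)))
  Joins-unique (inj₂ (p , q)) (inj₁ (r , s)) = simple G _ _ (inj₂ (trans p (sym s) , trans q (sym r)))
  Joins-unique (inj₂ (p , q)) (inj₂ (r , s)) = simple G _ _ (inj₁ (trans p (sym r) , trans q (sym s)))

  Touches⇒Joins : ∀ {e a b} → Touches e a → Touches e b → a ≢ b → Joins G e a b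
  Touches⇒Joins (inj₁ refl) (inj₁ refl) a≢b = ⊥-elim (a≢b refl)
  Touches⇒Joins (inj₁ refl) (inj₂ refl) _   = inj₁ (refl , refl)
  Touches⇒Joins (inj₂ refl) (inj₁ refl) _   = inj₂ (refl , refl)
  Touches⇒Joins (inj₂ refl) (inj₂ refl) a≢b = ⊥-elim (a≢b refl)

  Joins-Touches : ∀ {e a b z} → Joins G e a b → Touches e z → z ≡ a ⊎ z ≡ b
  Joins-Touches (inj₁ (refl , _)) (inj₁ refl) = inj₁ refl
  Joins-Touches (inj₁ (_ , refl)) (inj₂ refl) = inj₂ refl
  Joins-Touches (inj₂ (refl , _)) (inj₁ refl) = inj₂ refl
  Joins-Touches (inj₂ (_ , refl)) (inj₂ refl) = inj₁ refl

  otherEnd : Fin m → V → V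
  otherEnd e z with src G e ≟ z
  ... | yes _ = tgt G e
  ... | no _  = src G e

  Touches⇒Joins-otherEnd : ∀ {e z} → Touches e z → Joins G e z (otherEnd e z)
  Touches⇒Joins-otherEnd {e} {z} t with src G e ≟ z | t
  ... | yes s≡z | _         = inj₁ (s≡z , refl)
  ... | no s≢z  | inj₁ s≡z  = ⊥-elim (s≢z s≡z)
  ... | no _    | inj₂ t≡z  = inj₂ (refl , t≡z)

  module _ {a b : V} {es : List (Fin m)} where

    verts-∷ : (W : Walk G a b es) → verts G W ≡ a ∷ tailVerts G W
    verts-∷ []         = refl
    verts-∷ (step _ _) = refl

    head∈verts : (W : Walk G a b es) → a ∈ verts G W
    head∈verts W = subst (a ∈_) (sym (verts-∷ W)) (here refl)

  initVerts : ∀ {a b es} → Walk G a b es → List V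
  initVerts []             = []
  initVerts {a} (step _ W) = a ∷ initVerts W

  verts-∷ʳ : ∀ {a b es} (W : Walk G a b es) → verts G W ≡ initVerts W ∷ʳ b
  verts-∷ʳ []         = refl
  verts-∷ʳ (step _ W) = cong (_ ∷_) (verts-∷ʳ W)

  initVerts⊆verts : ∀ {a b es} (W : Walk G a b es) → initVerts W ⊆ verts G W
  initVerts⊆verts W q∈init = subst (_ ∈_) (sym (verts-∷ʳ W)) (∈-++⁺ˡ q∈init)

  length-initVerts : ∀ {a b es} (W : Walk G a b es) → length (initVerts W) ≡ length es
  length-initVerts []         = refl
  length-initVerts (step _ W) = cong suc (length-initVerts W)

  length-tailVerts : ∀ {a b es} (W : Walk G a b es) → length (tailVerts G W) ≡ length es
  length-tailVerts []         = refl
  length-tailVerts (step _ W) = trans (cong length (verts-∷ W)) (cong suc (length-tailVerts W))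

  IsPath⇒head∉tailVerts : ∀ {a b es} (W : Walk G a b es) → IsPath G W → a ∉ tailVerts G W
  IsPath⇒head∉tailVerts W p = Unique[x∷xs]⇒x∉xs (subst Unique (verts-∷ W) p)

  IsPath⇒Unique-last∷initVerts : ∀ {a b es} (W : Walk G a b es) → IsPath G W → Unique (b ∷ initVerts W)
  IsPath⇒Unique-last∷initVerts W p = Unique-∷ʳ⇒∷ (initVerts W) (subst Unique (verts-∷ʳ W) p)

  Touches⇒∈verts : ∀ {a b es e z} (W : Walk G a b es) → e ∈ es → Touches e z → z ∈ verts G W
  Touches⇒∈verts (step j W) (here refl) t with Joins-Touches j t
  ... | inj₁ refl = here refl
  ... | inj₂ refl = there (head∈verts W)
  Touches⇒∈verts (step j W) (there e∈es) t = there (Touches⇒∈verts W e∈es t)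

  IsPath⇒Unique-edges : ∀ {a b es} (W : Walk G a b es) → IsPath G W → Unique es
  IsPath⇒Unique-edges []         _       = []
  IsPath⇒Unique-edges (step j W) (a∉ ∷ p) =
    Unique-∷ (λ e∈es → All.lookup a∉ (Touches⇒∈verts W e∈es (Joins⇒Touches j)) refl) (IsPath⇒Unique-edges W p)

  -- A shared edge would have both endpoints equal to v.
  meetingAt⇒EdgeDisjoint : ∀ {a b a′ b′ v es fs} (W : Walk G a b es) (W′ : Walk G a′ b′ fs) →
                           (∀ {q} → q ∈ verts G W → q ∈ verts G W′ → q ≡ v) → EdgeDisjoint es fs
  meetingAt⇒EdgeDisjoint W W′ meet e e∈es e∈fs =
    loopless G e (trans (meet (Touches⇒∈verts W e∈es (inj₁ refl)) (Touches⇒∈verts W′ e∈fs (inj₁ refl)))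
                   (sym (meet (Touches⇒∈verts W e∈es (inj₂ refl)) (Touches⇒∈verts W′ e∈fs (inj₂ refl)))))

  reverseOnto : ∀ {a b z es fs} → Walk G a b es → Walk G a z fs → Walk G b z (es ʳ++ fs)
  reverseOnto []         acc = acc
  reverseOnto (step j W) acc = reverseOnto W (step (Joins-sym j) acc)

  reverseWalk : ∀ {a b es} → Walk G a b es → Walk G b a (reverse es)
  reverseWalk W = reverseOnto W []

  verts-reverseOnto : ∀ {a b z es fs} (W : Walk G a b es) (acc : Walk G a z fs) →
                      verts G (reverseOnto W acc) ≡ tailVerts G W ʳ++ verts G acc
  verts-reverseOnto []         acc = refl
  verts-reverseOnto (step j W) acc =
    trans (verts-reverseOnto W (step (Joins-sym j) acc)) (cong (_ʳ++ verts G acc) (sym (verts-∷ W)))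

  verts-reverseWalk : ∀ {a b es} (W : Walk G a b es) → verts G (reverseWalk W) ≡ reverse (verts G W)
  verts-reverseWalk W = trans (verts-reverseOnto W []) (cong reverse (sym (verts-∷ W)))

  ∈-reverseWalk : ∀ {a b es} (W : Walk G a b es) → verts G (reverseWalk W) ⊆ verts G W
  ∈-reverseWalk W q∈ = ∈-resp-↭ (↭-reverse (verts G W)) (subst (_ ∈_) (verts-reverseWalk W) q∈)

  reverseWalk-IsPath : ∀ {a b es} (W : Walk G a b es) → IsPath G W → IsPath G (reverseWalk W)
  reverseWalk-IsPath W p = subst Unique (sym (verts-reverseWalk W)) (Unique-↭ (↭-sym (↭-reverse (verts G W))) p)

  data _≼_ : ∀ {a b c es fs} → Walk G a b es → Walk G a c fs → Set where
    []   : ∀ {a c fs} {W : Walk G a c fs} → [] ≼ W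
    step : ∀ {a a′ b c e es fs} {j : Joins G e a a′} {W₁ : Walk G a′ b es} {W : Walk G a′ c fs} →
           W₁ ≼ W → step j W₁ ≼ step j W

  prefixTo : ∀ {a b c fs} (W : Walk G a c fs) → b ∈ verts G W → ∃₂ λ es (W₁ : Walk G a b es) → W₁ ≼ W
  prefixTo []         (here refl) = _ , [] , []
  prefixTo (step _ _) (here refl) = _ , [] , []
  prefixTo (step j W) (there b∈W) = let _ , W₁ , W₁≼W = prefixTo W b∈W in _ , step j W₁ , step W₁≼W

  ≼-verts : ∀ {a b c es fs} {W₁ : Walk G a b es} {W : Walk G a c fs} → W₁ ≼ W → verts G W₁ ⊆ verts G W
  ≼-verts {W = W} []  (here refl)  = head∈verts W
  ≼-verts (step _)    (here refl)  = here refl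
  ≼-verts (step W₁≼W) (there q∈W₁) = there (≼-verts W₁≼W q∈W₁)

  ≼-edges : ∀ {a b c es fs} {W₁ : Walk G a b es} {W : Walk G a c fs} → W₁ ≼ W → es ⊆ fs
  ≼-edges (step _)    (here refl)  = here refl
  ≼-edges (step W₁≼W) (there e∈es) = there (≼-edges W₁≼W e∈es)

  ≼-IsPath : ∀ {a b c es fs} {W₁ : Walk G a b es} {W : Walk G a c fs} → W₁ ≼ W → IsPath G W → IsPath G W₁
  ≼-IsPath []          _         = [] ∷ []
  ≼-IsPath (step W₁≼W) (a∉W ∷ p) =
    Unique-∷ (λ a∈W₁ → All.lookup a∉W (≼-verts W₁≼W a∈W₁) refl) (≼-IsPath W₁≼W p)

  closingEdge⇒IsCycle : ∀ {f y z es} (W : Walk G z y es) → IsPath G W → (j : Joins G f y z) → f ∉ es → IsCycle G (step j W)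
  closingEdge⇒IsCycle W p j f∉es = length≥3 W j f∉es , Unique-∷ f∉es (IsPath⇒Unique-edges W p) , p
    where
    length≥3 : ∀ {f y z es} (W : Walk G z y es) → Joins G f y z → f ∉ es → 3 ≤ length (f ∷ es)
    length≥3 []                  j _    = ⊥-elim (Joins-irrefl j)
    length≥3 (step h [])         j f∉es = ⊥-elim (f∉es (here (Joins-unique j (Joins-sym h))))
    length≥3 (step _ (step _ _)) _ _    = s≤s (s≤s (s≤s z≤n))

  chord⇒cycle : ∀ {z y b e es f} (W : Walk G z b (e ∷ es)) → IsPath G W → f ≢ e → Joins G f z y → y ∈ verts G W →
                ∃₂ λ x fs → Σ (Walk G x x fs) λ C → IsCycle G C × fs ⊆ f ∷ e ∷ es
  chord⇒cycle (step h W) _ _ j (here refl) = ⊥-elim (Joins-irrefl j)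
  chord⇒cycle {e = e} {f = f} (step h W) (z∉W ∷ p) f≢e j (there y∈W) with prefixTo W y∈W
  ... | es₁ , W₁ , W₁≼W =
    _ , _ , step (Joins-sym j) (step h W₁) ,
    closingEdge⇒IsCycle (step h W₁) (≼-IsPath hW₁≼hW (z∉W ∷ p)) (Joins-sym j) f∉ , edges⊆
    where
    hW₁≼hW : step h W₁ ≼ step h W
    hW₁≼hW = step W₁≼W
    f∉ : f ∉ e ∷ es₁
    f∉ (here f≡e)   = f≢e f≡e
    f∉ (there f∈W₁) = All.lookup z∉W (≼-verts W₁≼W (Touches⇒∈verts W₁ f∈W₁ (Joins⇒Touches j))) refl
    edges⊆ : f ∷ e ∷ es₁ ⊆ f ∷ _
    edges⊆ (here refl)  = here refl
    edges⊆ (there e∈es) = there (≼-edges hW₁≼hW e∈es)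

  record Extension {z₀ : V} (Inv : ∀ {z es} → Walk G z z₀ es → Set) {z es} (W : Walk G z z₀ es) : Set where
    constructor extension
    field
      {y}       : V
      {f}       : Fin m
      joins     : Joins G f y z
      fresh     : y ∉ verts G W
      invariant : Inv (step joins W)

  -- A path has at most n vertices, so it cannot be extended forever.
  growPath : ∀ {z₀ : V} {Goal : Set} (Inv : ∀ {z es} → Walk G z z₀ es → Set) →
             (∀ {z es} (W : Walk G z z₀ es) → IsPath G W → Inv W → Goal ⊎ Extension Inv W) →
             Inv [] → Goal
  growPath {z₀} {Goal} Inv extend inv₀ = go n [] ([] ∷ []) inv₀ (m<m+n n (s≤s z≤n))
    where
    go : ∀ fuel {z es} (W : Walk G z z₀ es) → IsPath G W → Inv W → n < fuel + length (verts G W) → Goal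
    go zero       W p _   n< = ⊥-elim (<⇒≱ n< (Unique-Fin⇒length≤ p))
    go (suc fuel) W p inv n< with extend W p inv
    ... | inj₁ goal                     = goal
    ... | inj₂ (extension j fresh inv′) =
      go fuel (step j W) (Unique-∷ fresh p) inv′ (subst (n <_) (sym (+-suc fuel _)) n<)

  internallyDisjoint⇒length≤ : ∀ {u v es fs} (P : Walk G u v es) (Q : Walk G u v fs) → IsPath G P → IsPath G Q →
                               (∀ {q} → q ∈ verts G P → q ∈ verts G Q → q ≡ u ⊎ q ≡ v) →
                               length es + length fs ≤ n
  internallyDisjoint⇒length≤ {u} {v} {es} {fs} P Q pathP pathQ meet
    with IsPath⇒Unique-last∷initVerts P pathP | subst Unique (verts-∷ Q) pathQ
  ... | v∉init ∷ uniqueInit | _ ∷ uniqueTail =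
    subst (_≤ n) lengths (Unique-Fin⇒length≤ (++⁺ uniqueInit uniqueTail disjoint))
    where
    disjoint : Disjoint (initVerts P) (tailVerts G Q)
    disjoint (q∈init , q∈tail) with meet (initVerts⊆verts P q∈init) (subst (_ ∈_) (sym (verts-∷ Q)) (there q∈tail))
    ... | inj₁ refl = IsPath⇒head∉tailVerts Q pathQ q∈tail
    ... | inj₂ refl = All.lookup v∉init q∈init refl
    lengths : length (initVerts P ++ tailVerts G Q) ≡ length es + length fs
    lengths = trans (length-++ (initVerts P)) (cong₂ _+_ (length-initVerts P) (length-tailVerts Q))

  CycleIn : List (Fin m) → Set
  CycleIn T = ∃₂ λ x es → Σ (Walk G x x es) λ W → IsCycle G W × es ⊆ T

  incident : List (Fin m) → V → List (Fin m)
  incident T z = filter (λ e → touches? e z) T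

  module _ (T : List (Fin m)) (uniqueT : Unique T) where

    minDegree2⇒cycle : (Vs : List V) → (∀ {e z} → e ∈ T → Touches e z → z ∈ Vs) →
                       (∀ {z} → z ∈ Vs → 2 ≤ length (incident T z)) → ∀ {z₀} → z₀ ∈ Vs → CycleIn T
    minDegree2⇒cycle Vs ends degree≥2 {z₀} z₀∈Vs = growPath Inv extend ((λ { (here refl) → z₀∈Vs }) , λ ())
      where
      open import Data.List.Membership.DecPropositional {A = V} _≟_ using (_∈?_)

      Inv : ∀ {z es} → Walk G z z₀ es → Set
      Inv {es = es} W = verts G W ⊆ Vs × es ⊆ T

      chordCycle : ∀ {z f e es} (W : Walk G z z₀ (e ∷ es)) → IsPath G W → e ∷ es ⊆ T → f ∈ T → (t : Touches f z) →
                   f ≢ e → otherEnd f z ∈ verts G W → CycleIn T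
      chordCycle W p es⊆T f∈T t f≢e end∈W with chord⇒cycle W p f≢e (Touches⇒Joins-otherEnd t) end∈W
      ... | x , fs , C , isCycle , fs⊆ = x , fs , C , isCycle , λ e∈fs → case fs⊆ e∈fs of λ where
        (here refl) → f∈T
        (there e∈es) → es⊆T e∈es

      twoIncident : ∀ {z} → z ∈ Vs → ∃₂ λ f f′ → f ≢ f′ × (f ∈ T × Touches f z) × (f′ ∈ T × Touches f′ z)
      twoIncident z∈Vs with twoDistinct (filter⁺ _ uniqueT) (degree≥2 z∈Vs)
      ... | f , f′ , f≢f′ , f∈ , f′∈ = f , f′ , f≢f′ , ∈-filter⁻ _ {xs = T} f∈ , ∈-filter⁻ _ {xs = T} f′∈

      closeUp : ∀ {z es} (W : Walk G z z₀ es) → IsPath G W → Inv W →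
                (∀ {f} → f ∈ T → Touches f z → otherEnd f z ∈ verts G W) → CycleIn T
      closeUp [] _ (W⊆Vs , _) back with twoIncident (W⊆Vs (here refl))
      ... | f , _ , _ , (f∈T , t) , _ with back f∈T t
      ...   | here end≡z = ⊥-elim (Joins-irrefl (subst (Joins G f _) end≡z (Touches⇒Joins-otherEnd t)))
      closeUp W@(step {e = h} _ _) p (W⊆Vs , es⊆T) back with twoIncident (W⊆Vs (here refl))
      ... | f₁ , f₂ , f₁≢f₂ , (f₁∈T , t₁) , (f₂∈T , t₂) with f₁ ≟ h
      ...   | yes refl = chordCycle W p es⊆T f₂∈T t₂ (f₁≢f₂ ∘ sym) (back f₂∈T t₂)
      ...   | no f₁≢h  = chordCycle W p es⊆T f₁∈T t₁ f₁≢h (back f₁∈T t₁)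

      extend : ∀ {z es} (W : Walk G z z₀ es) → IsPath G W → Inv W → CycleIn T ⊎ Extension Inv W
      extend {z} W p (W⊆Vs , es⊆T) with any? (λ f → touches? f z ×-dec ¬? (otherEnd f z ∈? verts G W)) T
      ... | yes found =
        let f , f∈T , t , fresh = find found
            j = Touches⇒Joins-otherEnd t
        in inj₂ (extension (Joins-sym j) fresh
                   ((λ { (here refl) → ends f∈T (Joins⇒Touches (Joins-sym j)) ; (there q∈W) → W⊆Vs q∈W }) ,
                    (λ { (here refl) → f∈T ; (there e∈es) → es⊆T e∈es })))
      ... | no none =
        inj₁ (closeUp W p (W⊆Vs , es⊆T)
               (λ f∈T t → decidable-stable (otherEnd _ z ∈? verts G W) (λ fresh → none (lose f∈T (t , fresh)))))

  anotherEndpoint : ∀ {Vs T} z → (∀ {e q} → e ∈ T → Touches e q → q ∈ Vs) → 0 < length T → ∃ λ q → q ∈ Vs × q ≢ z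
  anotherEndpoint {T = e ∷ _} z ends _ with src G e ≟ z
  ... | yes refl = tgt G e , ends (here refl) (inj₂ refl) , λ t≡s → loopless G e (sym t≡s)
  ... | no s≢z   = src G e , ends (here refl) (inj₁ refl) , s≢z

  -- Deleting a vertex of degree at most 1 with its edges preserves the hypotheses; if there is none,
  -- every vertex has degree at least 2.
  edges≥vertices⇒cycle : (Vs : List V) (T : List (Fin m)) → Unique T → (∀ {e z} → e ∈ T → Touches e z → z ∈ Vs) →
                         0 < length Vs → length Vs ≤ length T → CycleIn T
  edges≥vertices⇒cycle Vs T = go (length Vs) Vs T ≤-refl
    where
    go : ∀ fuel (Vs : List V) (T : List (Fin m)) → length Vs ≤ fuel → Unique T →
         (∀ {e z} → e ∈ T → Touches e z → z ∈ Vs) → 0 < length Vs → length Vs ≤ length T → CycleIn T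
    go _          []         _ _  _       _    ()  _
    go zero       (_ ∷ _)    _ () _       _    _   _
    go (suc fuel) Vs@(_ ∷ _) T bound uniqueT ends _ dense with any? (λ z → length (incident T z) ≤? 1) Vs
    ... | no none = minDegree2⇒cycle T uniqueT Vs ends (λ z∈Vs → ≰⇒> (none ∘ lose z∈Vs)) (here refl)
    ... | yes found with find found
    ...   | z , z∈Vs , degree≤1 =
      let x , es , W , isCycle , es⊆T′ = go fuel Vs′ T′ bound′ (filter⁺ avoids? uniqueT) ends′ nonempty′ dense′
      in x , es , W , isCycle , proj₁ ∘ ∈-filter⁻ avoids? {xs = T} ∘ es⊆T′
      where
      other? : ∀ q → Dec (q ≢ z)
      other? q = ¬? (q ≟ z)
      avoids? : ∀ e → Dec (¬ Touches e z)
      avoids? e = ¬? (touches? e z)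
      Vs′ : List V
      Vs′ = filter other? Vs
      T′ : List (Fin m)
      T′ = filter avoids? T
      shrink : length Vs′ < length Vs
      shrink = filter-notAll other? Vs (lose z∈Vs (λ z≢z → z≢z refl))
      bound′ : length Vs′ ≤ fuel
      bound′ = ≤-pred (≤-trans shrink bound)
      ends′ : ∀ {e q} → e ∈ T′ → Touches e q → q ∈ Vs′
      ends′ e∈T′ t with ∈-filter⁻ avoids? {xs = T} e∈T′
      ... | e∈T , ¬t = ∈-filter⁺ other? (ends e∈T t) λ { refl → ¬t t }
      dense′ : length Vs′ ≤ length T′
      dense′ = ≤-pred (begin
        suc (length Vs′)                    ≤⟨ shrink ⟩
        length Vs                           ≤⟨ dense ⟩
        length T                            ≡⟨ sym (length-filter+∁ (λ e → touches? e z) T) ⟩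
        length (incident T z) + length T′   ≤⟨ +-monoˡ-≤ (length T′) degree≤1 ⟩
        suc (length T′)                     ∎)
        where open ≤-Reasoning
      nonempty′ : 0 < length Vs′
      nonempty′ with anotherEndpoint z ends (≤-trans (s≤s z≤n) dense)
      ... | q , q∈Vs , q≢z = ∈⇒0<length (∈-filter⁺ other? q∈Vs q≢z)

colourCount≢0⇒coloured : ∀ {m k} (c : Fin m → Fin k) i → colourCount c i ≢ 0 → ∃ λ e → c e ≡ i
colourCount≢0⇒coloured {m} c i =
  nonempty (filter (λ e → c e ≟ i) (allFin m)) (proj₂ ∘ ∈-filter⁻ (λ e → c e ≟ i) {xs = allFin m})
  where
  nonempty : (L : List (Fin m)) → (∀ {e} → e ∈ L → c e ≡ i) → length L ≢ 0 → ∃ λ e → c e ≡ i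
  nonempty []      _   L≢0 = ⊥-elim (L≢0 refl)
  nonempty (e ∷ _) out _   = e , out (here refl)

module Colouring {k m : ℕ} (G : Graph (suc (suc k)) m) (c : Fin m → Fin (suc k))
                 (e₁ : Fin m) (c-e₁ : c e₁ ≡ zero) (others-repeated : ∀ i → i ≢ zero → 2 ≤ colourCount c i)
                 (noRainbowCycle : NoRainbowCycle G c) where

  open Walks G
  open import Data.List.Membership.DecPropositional {A = V} _≟_ using (_∈?_)

  Colour : Set
  Colour = Fin (suc k)

  colourClass : Colour → List (Fin m)
  colourClass i = filter (λ e → c e ≟ i) (allFin m)

  ∈-colourClass⁺ : ∀ {e i} → c e ≡ i → e ∈ colourClass i
  ∈-colourClass⁺ {e} {i} = ∈-filter⁺ (λ e → c e ≟ i) (∈-allFin e)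

  ∈-colourClass⁻ : ∀ {e i} → e ∈ colourClass i → c e ≡ i
  ∈-colourClass⁻ {i = i} e∈ = proj₂ (∈-filter⁻ (λ e → c e ≟ i) {xs = allFin m} e∈)

  record ColourPair (i : Colour) : Set where
    field
      edge     : Bool → Fin m
      distinct : edge true ≢ edge false
      colour   : ∀ s → c (edge s) ≡ i

  colourPair : ∀ {i} → i ≢ zero → ColourPair i
  colourPair {i} i≢0 with twoDistinct (filter⁺ (λ e → c e ≟ i) (allFin⁺ m)) (others-repeated i i≢0)
  ... | f , f′ , f≢f′ , f∈ , f′∈ = record { edge = edge ; distinct = f≢f′ ; colour = colour }
    where
    edge : Bool → Fin m
    edge true  = f
    edge false = f′
    colour : ∀ s → c (edge s) ≡ i
    colour true  = ∈-colourClass⁻ f∈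
    colour false = ∈-colourClass⁻ f′∈

  x y : V
  x = src G e₁
  y = tgt G e₁

  Inner : V → Set
  Inner w = w ≢ x × w ≢ y

  inner? : ∀ w → Dec (Inner w)
  inner? w = ¬? (w ≟ x) ×-dec ¬? (w ≟ y)

  Owns : V → Colour → Set
  Owns w i = i ≢ zero × (∀ {e} → c e ≡ i → Touches e w)

  owns? : ∀ w i → Dec (Owns w i)
  owns? w i = ¬? (i ≟ zero) ×-dec map′ (λ all ce → All.lookup all (∈-colourClass⁺ ce))
                                         (λ touch → All.tabulate (λ e∈ → touch (∈-colourClass⁻ e∈)))
                                         (All.all? (λ e → touches? e w) (colourClass i))

  Owns-injective : ∀ {w w′ i} → Owns w i → Owns w′ i → w ≡ w′
  Owns-injective {w} {w′} (i≢0 , touch) (_ , touch′) with w ≟ w′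
  ... | yes w≡w′ = w≡w′
  ... | no w≢w′  = ⊥-elim (distinct (Joins-unique (joins true) (joins false)))
    where
    open ColourPair (colourPair i≢0)
    joins : ∀ s → Joins G (edge s) w w′
    joins s = Touches⇒Joins (touch (colour s)) (touch′ (colour s)) w≢w′

  ¬Owns⇒avoidingEdge : ∀ {w} → Inner w → ∀ i → ¬ Owns w i → ∃ λ e → c e ≡ i × ¬ Touches e w
  ¬Owns⇒avoidingEdge {w} (w≢x , w≢y) i ¬owns with i ≟ zero
  ... | yes refl = e₁ , c-e₁ , λ { (inj₁ x≡w) → w≢x (sym x≡w) ; (inj₂ y≡w) → w≢y (sym y≡w) }
  ... | no i≢0   =
    let e , e∈ , ¬t = find (¬All⇒Any¬ (λ e → touches? e w) (colourClass i)
                                       (λ all → ¬owns (i≢0 , λ ce → All.lookup all (∈-colourClass⁺ ce))))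
    in e , ∈-colourClass⁻ e∈ , ¬t

  -- Otherwise the transversal consists of n - 1 edges on the n - 1 vertices other than w,
  -- so it contains a cycle, and that cycle is rainbow.
  transversal-hits : ∀ w (pick : Colour → Fin m) → (∀ i → c (pick i) ≡ i) → ¬ (∀ i → ¬ Touches (pick i) w)
  transversal-hits w pick c-pick misses =
    let _ , _ , W , isCycle , es⊆T = edges≥vertices⇒cycle Vs T uniqueT ends nonempty dense
    in noRainbowCycle _ _ W isCycle
         (Unique-map-injectiveOn (λ e∈ e′∈ → c-injectiveOnT (es⊆T e∈) (es⊆T e′∈)) (proj₁ (proj₂ isCycle)))
    where
    T : List (Fin m)
    T = map pick (allFin (suc k))

    uniqueT : Unique T
    uniqueT = map⁺ (λ {i} {j} pick-i≡pick-j → trans (sym (c-pick i)) (trans (cong c pick-i≡pick-j) (c-pick j))) (allFin⁺ _)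

    ∈T⇒pick : ∀ {e} → e ∈ T → e ≡ pick (c e)
    ∈T⇒pick e∈T with ∈-map⁻ pick {xs = allFin (suc k)} e∈T
    ... | i , _ , refl = cong pick (sym (c-pick i))

    c-injectiveOnT : ∀ {e e′} → e ∈ T → e′ ∈ T → c e ≡ c e′ → e ≡ e′
    c-injectiveOnT e∈T e′∈T ce≡ce′ = trans (∈T⇒pick e∈T) (trans (cong pick ce≡ce′) (sym (∈T⇒pick e′∈T)))

    notW? : ∀ q → Dec (q ≢ w)
    notW? q = ¬? (q ≟ w)

    Vs : List V
    Vs = filter notW? (allFin (suc (suc k)))

    ends : ∀ {e q} → e ∈ T → Touches e q → q ∈ Vs
    ends {e} {q} e∈T t =
      ∈-filter⁺ notW? (∈-allFin q) λ { refl → misses (c e) (subst (λ e → Touches e q) (∈T⇒pick e∈T) t) }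

    nonempty : 0 < length Vs
    nonempty = ∈⇒0<length (∈-filter⁺ notW? (∈-allFin (src G (pick zero))) (λ s≡w → misses zero (inj₁ s≡w)))

    dense : length Vs ≤ length T
    dense = ≤-pred (begin
      suc (length Vs)                 ≤⟨ filter-notAll notW? (allFin _) (lose (∈-allFin w) λ w≢w → w≢w refl) ⟩
      length (allFin (suc (suc k)))   ≡⟨ length-tabulate {n = suc (suc k)} (λ i → i) ⟩
      suc (suc k)                     ≡⟨ cong suc (sym (length-tabulate {n = suc k} (λ i → i))) ⟩
      suc (length (allFin (suc k)))   ≡⟨ cong suc (sym (length-map pick (allFin (suc k)))) ⟩
      suc (length T)                  ∎)
      where open ≤-Reasoning

  inner⇒owns : ∀ {w} → Inner w → ¬ (∀ i → ¬ Owns w i)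
  inner⇒owns {w} inner ownsNothing =
    transversal-hits w (proj₁ ∘ avoiding) (proj₁ ∘ proj₂ ∘ avoiding) (proj₂ ∘ proj₂ ∘ avoiding)
    where
    avoiding : ∀ i → ∃ λ e → c e ≡ i × ¬ Touches e w
    avoiding i = ¬Owns⇒avoidingEdge inner i (ownsNothing i)

  colourOf : V → Colour
  colourOf w with any? (owns? w) (allFin (suc k))
  ... | yes owned = proj₁ (satisfied owned)
  ... | no _      = zero

  owns-colourOf : ∀ {w} → Inner w → Owns w (colourOf w)
  owns-colourOf {w} inner with any? (owns? w) (allFin (suc k))
  ... | yes owned = proj₂ (satisfied owned)
  ... | no none   = ⊥-elim (inner⇒owns inner λ i owns → none (lose (∈-allFin i) owns))

  colourOf-injective : ∀ {w w′} → Inner w → Inner w′ → colourOf w ≡ colourOf w′ → w ≡ w′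
  colourOf-injective inner inner′ eq = Owns-injective (owns-colourOf inner) (subst (Owns _) (sym eq) (owns-colourOf inner′))

  Arc : V → V → Set
  Arc w v = Inner w × ∃ λ e → c e ≡ colourOf w × Joins G e w v

  arc? : ∀ w v → Dec (Arc w v)
  arc? w v = inner? w ×-dec map′ (λ found → let e , _ , p = find found in e , p) (λ (e , p) → lose (∈-allFin e) p)
                                  (any? (λ e → (c e ≟ colourOf w) ×-dec joins? e w v) (allFin m))

  record OutEdges (w : V) : Set where
    field
      edge          : Bool → Fin m
      nbr           : Bool → V
      colour        : ∀ s → c (edge s) ≡ colourOf w
      joins         : ∀ s → Joins G (edge s) w (nbr s)
      edge-distinct : ∀ s → edge s ≢ edge (not s)
      nbr-distinct  : ∀ s → nbr s ≢ nbr (not s)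

  outEdges : ∀ {w} → Inner w → OutEdges w
  outEdges {w} inner = record
    { edge          = edge
    ; nbr           = nbr
    ; colour        = colour
    ; joins         = joins
    ; edge-distinct = edge-distinct
    ; nbr-distinct  = λ s nbr≡ → edge-distinct s (Joins-unique (joins s) (subst (Joins G _ w) (sym nbr≡) (joins (not s))))
    }
    where
    open ColourPair (colourPair (proj₁ (owns-colourOf inner)))
    nbr : Bool → V
    nbr s = otherEnd (edge s) w
    joins : ∀ s → Joins G (edge s) w (nbr s)
    joins s = Touches⇒Joins-otherEnd (proj₂ (owns-colourOf inner) (colour s))
    edge-distinct : ∀ s → edge s ≢ edge (not s)
    edge-distinct true  = distinct
    edge-distinct false = distinct ∘ sym

  Closed : List V → Set
  Closed D = ∀ {w v} → w ∈ D → Arc w v → v ∈ D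

  Source : List V → V → Set
  Source D w = w ∈ D × Inner w × (∀ {w′} → w′ ∈ D → ¬ Arc w′ w)

  Directed : ∀ {a b es} → Walk G a b es → Set
  Directed []                           = ⊤
  Directed (step {x = a} {e = e} _ W) = (Inner a × c e ≡ colourOf a) × Directed W

  ≼-Directed : ∀ {a b c es fs} {W₁ : Walk G a b es} {W : Walk G a c fs} → W₁ ≼ W → Directed W → Directed W₁
  ≼-Directed []          _                  = tt
  ≼-Directed (step W₁≼W) (arc , directed) = arc , ≼-Directed W₁≼W directed

  -- Each edge has the colour owned by its tail, and distinct vertices own distinct colours.
  directed⇒rainbow : ∀ {a b es} (W : Walk G a b es) → Directed W → Unique (initVerts W) → Rainbow c es
  directed⇒rainbow W directed u =
    subst Unique (sym (colours W directed))
      (Unique-map-injectiveOn (λ p∈ q∈ → colourOf-injective (inner W directed p∈) (inner W directed q∈)) u)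
    where
    colours : ∀ {a b es} (W : Walk G a b es) → Directed W → map c es ≡ map colourOf (initVerts W)
    colours []         _                     = refl
    colours (step _ W) ((_ , ce) , directed) = cong₂ _∷_ ce (colours W directed)
    inner : ∀ {a b es} (W : Walk G a b es) → Directed W → ∀ {q} → q ∈ initVerts W → Inner q
    inner (step _ W) ((inner-a , _) , _) (here refl) = inner-a
    inner (step _ W) (_ , directed)      (there q∈)  = inner W directed q∈

  -- Following arcs backwards inside D from w₀ either reaches a source or closes a directed, hence rainbow, cycle.
  findSource : ∀ {D w₀} → w₀ ∈ D → Inner w₀ → ∃ (Source D)
  findSource {D} {w₀} w₀∈D inner₀ with any? (λ w → inner? w ×-dec All.all? (λ w′ → ¬? (arc? w′ w)) D) D
  ... | yes found = let w , w∈D , inner , noArc = find found in w , w∈D , inner , All.lookup noArc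
  ... | no none   = ⊥-elim (growPath Inv extend ((λ { (here refl) → w₀∈D }) , tt))
    where
    predecessor : ∀ {z} → z ∈ D → Inner z → ∃ λ w′ → w′ ∈ D × Arc w′ z
    predecessor {z} z∈D inner with All.all? (λ w′ → ¬? (arc? w′ z)) D
    ... | yes noArc  = ⊥-elim (none (lose z∈D (inner , noArc)))
    ... | no someArc =
      let w′ , w′∈D , ¬¬arc = find (¬All⇒Any¬ (λ w′ → ¬? (arc? w′ z)) D someArc)
      in w′ , w′∈D , decidable-stable (arc? w′ z) ¬¬arc

    Inv : ∀ {z es} → Walk G z w₀ es → Set
    Inv W = verts G W ⊆ D × Directed W

    head-inner : ∀ {z es} (W : Walk G z w₀ es) → Directed W → Inner z
    head-inner []         _                  = inner₀
    head-inner (step _ _) ((inner , _) , _) = inner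

    extend : ∀ {z es} (W : Walk G z w₀ es) → IsPath G W → Inv W → ⊥ ⊎ Extension Inv W
    extend W p (W⊆D , directed) with predecessor (W⊆D (head∈verts W)) (head-inner W directed)
    ... | w′ , w′∈D , (inner′ , g , cg , j) with w′ ∈? verts G W
    ...   | no fresh =
      inj₂ (extension j fresh ((λ { (here refl) → w′∈D ; (there q∈W) → W⊆D q∈W }) , ((inner′ , cg) , directed)))
    ...   | yes w′∈W with prefixTo W w′∈W
    ...     | _ , W₁ , W₁≼W =
      inj₁ (noRainbowCycle w′ _ (step j W₁) (closingEdge⇒IsCycle W₁ pathW₁ j (Unique[x∷xs]⇒x∉xs (map⁻ rainbow))) rainbow)
      where
      pathW₁ : IsPath G W₁
      pathW₁ = ≼-IsPath W₁≼W p
      rainbow : Rainbow c (g ∷ _)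
      rainbow = directed⇒rainbow (step j W₁) ((inner′ , cg) , ≼-Directed W₁≼W directed)
                                 (IsPath⇒Unique-last∷initVerts W₁ pathW₁)

  record RainbowPath (D : List V) (a b : V) : Set where
    constructor rainbowPath
    field
      {edges} : List (Fin m)
      walk    : Walk G a b edges
      isPath  : IsPath G walk
      inside  : verts G walk ⊆ D
      rainbow : Rainbow c edges

  open RainbowPath

  Verts : ∀ {D a b} → RainbowPath D a b → List V
  Verts P = verts G (walk P)

  trivialPath : ∀ {D a} → a ∈ D → RainbowPath D a a
  trivialPath a∈D = rainbowPath [] ([] ∷ []) (λ { (here refl) → a∈D }) []

  edgePath : ∀ {D e a b} → Joins G e a b → a ∈ D → b ∈ D → RainbowPath D a b
  edgePath j a∈D b∈D =
    rainbowPath (step j []) (Unique-∷ (λ { (here refl) → Joins-irrefl j }) ([] ∷ []))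
                (λ { (here refl) → a∈D ; (there (here refl)) → b∈D }) ([] ∷ [])

  reversePath : ∀ {D a b} → RainbowPath D a b → RainbowPath D b a
  reversePath (rainbowPath {es} W p inside rb) =
    rainbowPath (reverseWalk W) (reverseWalk-IsPath W p) (inside ∘ ∈-reverseWalk W)
                (Unique-↭ (↭-sym (Permutation.map⁺ c (↭-reverse es))) rb)

  weakenPath : ∀ {D D′ a b} → D′ ⊆ D → RainbowPath D′ a b → RainbowPath D a b
  weakenPath D′⊆D (rainbowPath W p inside rb) = rainbowPath W p (D′⊆D ∘ inside) rb

  prepend : ∀ {D w g a b} → Inner w → c g ≡ colourOf w → Joins G g w a → w ∈ D →
            (P : RainbowPath D a b) → w ∉ Verts P → RainbowPath D w b
  prepend {w = w} inner cg j w∈D (rainbowPath W p inside rb) w∉P =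
    rainbowPath (step j W) (Unique-∷ w∉P p) (λ { (here refl) → w∈D ; (there q∈W) → inside q∈W })
                (Unique-∷ (λ cg∈ → let _ , e∈ , cg≡ce = ∈-map⁻ c cg∈
                                   in w∉P (Touches⇒∈verts W e∈ (proj₂ (owns-colourOf inner) (trans (sym cg≡ce) cg))))
                          rb)

  record Linkage (D : List V) (a b s t : V) : Set where
    constructor linkage
    field
      left     : RainbowPath D a s
      right    : RainbowPath D b t
      disjoint : Disjoint (Verts left) (Verts right)

  Link : List V → V → V → V → V → Set
  Link D a b s t = Linkage D a b s t ⊎ Linkage D a b t s

  record Fan (D : List V) (v a b : V) : Set where
    constructor fan
    field
      left  : RainbowPath D v a
      right : RainbowPath D v b
      meet  : ∀ {q} → q ∈ Verts left → q ∈ Verts right → q ≡ v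

  record TwoPaths (D : List V) (u v : V) : Set where
    constructor twoPaths
    field
      first second : RainbowPath D u v
      edgeDisjoint : EdgeDisjoint (edges first) (edges second)
      meet         : ∀ {q} → q ∈ Verts first → q ∈ Verts second → q ≡ u ⊎ q ≡ v

  swapLinkage : ∀ {D a b s t} → Linkage D a b s t → Linkage D b a t s
  swapLinkage (linkage L R disjoint) = linkage R L λ (q∈R , q∈L) → disjoint (q∈L , q∈R)

  reverseLinkage : ∀ {D a b s t} → Linkage D a b s t → Linkage D s t a b
  reverseLinkage (linkage L R disjoint) =
    linkage (reversePath L) (reversePath R)
            λ (q∈L , q∈R) → disjoint (∈-reverseWalk (walk L) q∈L , ∈-reverseWalk (walk R) q∈R)

  swapLink : ∀ {D a b s t} → Link D a b s t → Link D b a s t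
  swapLink (inj₁ l) = inj₂ (swapLinkage l)
  swapLink (inj₂ l) = inj₁ (swapLinkage l)

  swapTargets : ∀ {D a b s t} → Link D a b t s → Link D a b s t
  swapTargets (inj₁ l) = inj₂ l
  swapTargets (inj₂ l) = inj₁ l

  reverseLink : ∀ {D a b s t} → Link D s t a b → Link D a b s t
  reverseLink (inj₁ l) = inj₁ (reverseLinkage l)
  reverseLink (inj₂ l) = inj₂ (swapLinkage (reverseLinkage l))

  swapFan : ∀ {D v a b} → Fan D v a b → Fan D v b a
  swapFan (fan L R meet) = fan R L λ q∈R q∈L → meet q∈L q∈R

  reverseTwoPaths : ∀ {D u v} → TwoPaths D u v → TwoPaths D v u
  reverseTwoPaths (twoPaths P Q edgeDisjoint meet) =
    twoPaths (reversePath P) (reversePath Q)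
             (λ e e∈P e∈Q → edgeDisjoint e (∈-resp-↭ (↭-reverse _) e∈P) (∈-resp-↭ (↭-reverse _) e∈Q))
             (λ q∈P q∈Q → Sum.swap (meet (∈-reverseWalk (walk P) q∈P) (∈-reverseWalk (walk Q) q∈Q)))

  module _ {D D′ : List V} (D′⊆D : D′ ⊆ D) where

    weakenLink : ∀ {a b s t} → Link D′ a b s t → Link D a b s t
    weakenLink = Sum.map weaken weaken
      where
      weaken : ∀ {a b s t} → Linkage D′ a b s t → Linkage D a b s t
      weaken (linkage L R disjoint) = linkage (weakenPath D′⊆D L) (weakenPath D′⊆D R) disjoint

    weakenFan : ∀ {v a b} → Fan D′ v a b → Fan D v a b
    weakenFan (fan L R meet) = fan (weakenPath D′⊆D L) (weakenPath D′⊆D R) meet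

    weakenTwoPaths : ∀ {u v} → TwoPaths D′ u v → TwoPaths D u v
    weakenTwoPaths (twoPaths P Q edgeDisjoint meet) = twoPaths (weakenPath D′⊆D P) (weakenPath D′⊆D Q) edgeDisjoint meet

  record Linked (D : List V) : Set where
    field
      links     : ∀ {a b s t} → a ∈ D → b ∈ D → s ∈ D → t ∈ D → a ≢ b → s ≢ t → Link D a b s t
      fans      : ∀ {v a b} → v ∈ D → a ∈ D → b ∈ D → v ≢ a → v ≢ b → a ≢ b → Fan D v a b
      pathPairs : ∀ {u v} → u ∈ D → v ∈ D → u ≢ v → ¬ Joins G e₁ u v → TwoPaths D u v

  pathIn : ∀ {D a b} → Linked D → a ∈ D → b ∈ D → RainbowPath D a b
  pathIn {a = a} {b} linked a∈D b∈D with a ≟ b | joins? e₁ a b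
  ... | yes refl | _     = trivialPath a∈D
  ... | no _     | yes j = edgePath j a∈D b∈D
  ... | no a≢b   | no ¬j = TwoPaths.first (Linked.pathPairs linked a∈D b∈D a≢b ¬j)

  ¬Inner⇒terminal : ∀ {w} → ¬ Inner w → w ≡ x ⊎ w ≡ y
  ¬Inner⇒terminal {w} ¬inner with w ≟ x | w ≟ y
  ... | yes w≡x | _       = inj₁ w≡x
  ... | no _    | yes w≡y = inj₂ w≡y
  ... | no w≢x  | no w≢y  = ⊥-elim (¬inner (w≢x , w≢y))

  ¬Inner-pigeonhole : ∀ {p q r} → ¬ Inner p → ¬ Inner q → ¬ Inner r → p ≢ q → p ≢ r → q ≡ r
  ¬Inner-pigeonhole ¬p ¬q ¬r p≢q p≢r with ¬Inner⇒terminal ¬p | ¬Inner⇒terminal ¬q | ¬Inner⇒terminal ¬r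
  ... | inj₁ refl | inj₁ refl | _         = ⊥-elim (p≢q refl)
  ... | inj₂ refl | inj₂ refl | _         = ⊥-elim (p≢q refl)
  ... | _         | inj₁ refl | inj₁ refl = refl
  ... | _         | inj₂ refl | inj₂ refl = refl
  ... | inj₁ refl | _         | inj₁ refl = ⊥-elim (p≢r refl)
  ... | inj₂ refl | _         | inj₂ refl = ⊥-elim (p≢r refl)

  linked-¬Inner : ∀ {D} → (∀ {q} → q ∈ D → ¬ Inner q) → Linked D
  linked-¬Inner {D} terminal = record { links = links ; fans = fans ; pathPairs = pathPairs }
    where
    alone : ∀ {a b} → a ∈ D → b ∈ D → a ≢ b → Linkage D a b a b
    alone a∈D b∈D a≢b = linkage (trivialPath a∈D) (trivialPath b∈D) λ { (here refl , here refl) → a≢b refl }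

    links : ∀ {a b s t} → a ∈ D → b ∈ D → s ∈ D → t ∈ D → a ≢ b → s ≢ t → Link D a b s t
    links {a} {b} {s} {t} a∈D b∈D s∈D t∈D a≢b s≢t with a ≟ s
    ... | yes refl with ¬Inner-pigeonhole (terminal a∈D) (terminal b∈D) (terminal t∈D) a≢b s≢t
    ...   | refl = inj₁ (alone a∈D b∈D a≢b)
    links {a} {b} {s} {t} a∈D b∈D s∈D t∈D a≢b s≢t | no a≢s
      with ¬Inner-pigeonhole (terminal s∈D) (terminal a∈D) (terminal t∈D) (a≢s ∘ sym) s≢t
         | ¬Inner-pigeonhole (terminal a∈D) (terminal b∈D) (terminal s∈D) a≢b a≢s
    ... | refl | refl = inj₂ (alone a∈D b∈D a≢b)

    fans : ∀ {v a b} → v ∈ D → a ∈ D → b ∈ D → v ≢ a → v ≢ b → a ≢ b → Fan D v a b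
    fans v∈D a∈D b∈D v≢a v≢b a≢b =
      ⊥-elim (a≢b (¬Inner-pigeonhole (terminal v∈D) (terminal a∈D) (terminal b∈D) v≢a v≢b))

    pathPairs : ∀ {u v} → u ∈ D → v ∈ D → u ≢ v → ¬ Joins G e₁ u v → TwoPaths D u v
    pathPairs u∈D v∈D u≢v ¬j with ¬Inner⇒terminal (terminal u∈D) | ¬Inner⇒terminal (terminal v∈D)
    ... | inj₁ refl | inj₁ refl = ⊥-elim (u≢v refl)
    ... | inj₁ refl | inj₂ refl = ⊥-elim (¬j (inj₁ (refl , refl)))
    ... | inj₂ refl | inj₁ refl = ⊥-elim (¬j (inj₂ (refl , refl)))
    ... | inj₂ refl | inj₂ refl = ⊥-elim (u≢v refl)

  module RemoveSource {D : List V} (closed : Closed D) {w : V} (w∈D : w ∈ D) (inner : Inner w)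
                      (noArc : ∀ {w′} → w′ ∈ D → ¬ Arc w′ w) (out : OutEdges w) where

    notW? : ∀ q → Dec (q ≢ w)
    notW? q = ¬? (q ≟ w)

    D′ : List V
    D′ = filter notW? D

    D′⊆D : D′ ⊆ D
    D′⊆D = proj₁ ∘ ∈-filter⁻ notW? {xs = D}

    ∈D′ : ∀ {q} → q ∈ D → q ≢ w → q ∈ D′
    ∈D′ = ∈-filter⁺ notW?

    avoids : ∀ {a b} (P : RainbowPath D′ a b) → w ∉ Verts P
    avoids P w∈P = proj₂ (∈-filter⁻ notW? {xs = D} (inside P w∈P)) refl

    shorter : length D′ < length D
    shorter = filter-notAll notW? D (lose w∈D λ w≢w → w≢w refl)

    closed′ : Closed D′
    closed′ q∈D′ arc = ∈D′ (closed (D′⊆D q∈D′) arc) λ { refl → noArc (D′⊆D q∈D′) arc }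

    open OutEdges out

    nbr∈D′ : ∀ s → nbr s ∈ D′
    nbr∈D′ s = ∈D′ (closed w∈D (inner , edge s , colour s , joins s))
                   λ nbr≡w → Joins-irrefl (subst (Joins G _ w) nbr≡w (joins s))

    nbrAvoiding : ∀ b → ∃ λ s → nbr s ≢ b
    nbrAvoiding b with nbr true ≟ b
    ... | yes refl = false , nbr-distinct false
    ... | no nbr≢b = true , nbr≢b

    fromW : ∀ s {b} → RainbowPath D′ (nbr s) b → RainbowPath D w b
    fromW s P = prepend inner (colour s) (joins s) w∈D (weakenPath D′⊆D P) (avoids P)

    toW : ∀ s {a} → RainbowPath D′ a (nbr s) → RainbowPath D a w
    toW s P = reversePath (fromW s (reversePath P))

    ∈-toW : ∀ s {a q} (P : RainbowPath D′ a (nbr s)) → q ∈ Verts (toW s P) → q ≡ w ⊎ q ∈ Verts P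
    ∈-toW s P q∈ with ∈-reverseWalk (walk (fromW s (reversePath P))) q∈
    ... | here q≡w   = inj₁ q≡w
    ... | there q∈P′ = inj₂ (∈-reverseWalk (walk P) q∈P′)

    module _ (linked′ : Linked D′) where
      open Linked linked′

      twoPathsViaFan : ∀ {v} → Fan D′ v (nbr true) (nbr false) → TwoPaths D w v
      twoPathsViaFan {v} (fan L R meet) = twoPaths (fromW true (reversePath L)) (fromW false (reversePath R)) edgeDisjoint meet′
        where
        edgeDisjoint : EdgeDisjoint (edges (fromW true (reversePath L))) (edges (fromW false (reversePath R)))
        edgeDisjoint _ (here refl) (here eq) = edge-distinct true eq
        edgeDisjoint _ (here refl) (there e∈R) =
          avoids (reversePath R) (Touches⇒∈verts (walk (reversePath R)) e∈R (Joins⇒Touches (joins true)))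
        edgeDisjoint _ (there e∈L) (here refl) =
          avoids (reversePath L) (Touches⇒∈verts (walk (reversePath L)) e∈L (Joins⇒Touches (joins false)))
        edgeDisjoint e (there e∈L) (there e∈R) =
          meetingAt⇒EdgeDisjoint (walk (reversePath L)) (walk (reversePath R))
            (λ q∈L q∈R → meet (∈-reverseWalk (walk L) q∈L) (∈-reverseWalk (walk R) q∈R)) e e∈L e∈R
        meet′ : ∀ {q} → q ∈ w ∷ Verts (reversePath L) → q ∈ w ∷ Verts (reversePath R) → q ≡ w ⊎ q ≡ v
        meet′ (here q≡w)  _           = inj₁ q≡w
        meet′ (there _)   (here q≡w)  = inj₁ q≡w
        meet′ (there q∈L) (there q∈R) = inj₂ (meet (∈-reverseWalk (walk L) q∈L) (∈-reverseWalk (walk R) q∈R))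

      twoPathsToNbr : ∀ s → TwoPaths D w (nbr s)
      twoPathsToNbr s = twoPaths (fromW s (trivialPath (nbr∈D′ s))) (fromW (not s) R) edgeDisjoint meet
        where
        R : RainbowPath D′ (nbr (not s)) (nbr s)
        R = pathIn linked′ (nbr∈D′ (not s)) (nbr∈D′ s)
        edgeDisjoint : EdgeDisjoint (edge s ∷ []) (edge (not s) ∷ edges R)
        edgeDisjoint _ (here refl) (here eq)   = edge-distinct s eq
        edgeDisjoint _ (here refl) (there e∈R) = avoids R (Touches⇒∈verts (walk R) e∈R (Joins⇒Touches (joins s)))
        meet : ∀ {q} → q ∈ w ∷ nbr s ∷ [] → q ∈ Verts (fromW (not s) R) → q ≡ w ⊎ q ≡ nbr s
        meet (here q≡w)         _ = inj₁ q≡w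
        meet (there (here q≡v)) _ = inj₂ q≡v

      twoPathsFromW : ∀ {v} → v ∈ D′ → TwoPaths D w v
      twoPathsFromW {v} v∈D′ with nbr true ≟ v | nbr false ≟ v
      ... | yes refl | _        = twoPathsToNbr true
      ... | no _     | yes refl = twoPathsToNbr false
      ... | no ≢v    | no ≢v′   =
        twoPathsViaFan (fans v∈D′ (nbr∈D′ true) (nbr∈D′ false) (≢v ∘ sym) (≢v′ ∘ sym) (nbr-distinct true))

      fanViaLinkage : ∀ {a b} s → Linkage D′ a b (nbr s) (nbr (not s)) → Fan D w a b
      fanViaLinkage s (linkage L R disjoint) = fan (fromW s (reversePath L)) (fromW (not s) (reversePath R)) meet
        where
        meet : ∀ {q} → q ∈ w ∷ Verts (reversePath L) → q ∈ w ∷ Verts (reversePath R) → q ≡ w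
        meet (here q≡w)  _           = q≡w
        meet (there _)   (here q≡w)  = q≡w
        meet (there q∈L) (there q∈R) = ⊥-elim (disjoint (∈-reverseWalk (walk L) q∈L , ∈-reverseWalk (walk R) q∈R))

      fanFromW : ∀ {a b} → a ∈ D′ → b ∈ D′ → a ≢ b → Fan D w a b
      fanFromW a∈D′ b∈D′ a≢b with links a∈D′ b∈D′ (nbr∈D′ true) (nbr∈D′ false) a≢b (nbr-distinct true)
      ... | inj₁ l = fanViaLinkage true l
      ... | inj₂ l = fanViaLinkage false l

      fanToW : ∀ {v b} → v ∈ D′ → b ∈ D′ → v ≢ b → Fan D v w b
      fanToW {v} {b} v∈D′ b∈D′ v≢b with nbrAvoiding b
      ... | s , nbr≢b with nbr s ≟ v
      ...   | yes refl = fan (reversePath (fromW s (trivialPath v∈D′))) (weakenPath D′⊆D R) meet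
        where
        R : RainbowPath D′ (nbr s) b
        R = pathIn linked′ v∈D′ b∈D′
        meet : ∀ {q} → q ∈ Verts (reversePath (fromW s (trivialPath v∈D′))) → q ∈ Verts R → q ≡ nbr s
        meet q∈ q∈R with ∈-reverseWalk (walk (fromW s (trivialPath v∈D′))) q∈
        ... | here refl         = ⊥-elim (avoids R q∈R)
        ... | there (here q≡v)  = q≡v
      ...   | no nbr≢v with fans v∈D′ (nbr∈D′ s) b∈D′ (nbr≢v ∘ sym) v≢b nbr≢b
      ...     | fan L R meet = fan (toW s L) (weakenPath D′⊆D R) meet′
        where
        meet′ : ∀ {q} → q ∈ Verts (toW s L) → q ∈ Verts R → q ≡ v
        meet′ q∈ q∈R with ∈-toW s L q∈
        ... | inj₁ refl = ⊥-elim (avoids R q∈R)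
        ... | inj₂ q∈L  = meet q∈L q∈R

      linkageFromW : ∀ {b s t} r → Linkage D′ (nbr r) b s t → Linkage D w b s t
      linkageFromW r (linkage L R disjoint) = linkage (fromW r L) (weakenPath D′⊆D R) λ
        { (here refl  , q∈R) → avoids R q∈R
        ; (there q∈L , q∈R) → disjoint (q∈L , q∈R)
        }

      linkageFromW-trivial : ∀ {b t} → b ∈ D′ → t ∈ D′ → Linkage D w b w t
      linkageFromW-trivial {b} {t} b∈D′ t∈D′ =
        linkage (trivialPath w∈D) (weakenPath D′⊆D R) λ { (here refl , q∈R) → avoids R q∈R }
        where
        R : RainbowPath D′ b t
        R = pathIn linked′ b∈D′ t∈D′

      linkFromW : ∀ {b s t} → b ∈ D′ → s ∈ D → t ∈ D → s ≢ t → Link D w b s t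
      linkFromW {b} {s} {t} b∈D′ s∈D t∈D s≢t with s ≟ w | t ≟ w
      ... | yes refl | _        = inj₁ (linkageFromW-trivial b∈D′ (∈D′ t∈D (s≢t ∘ sym)))
      ... | no _     | yes refl = inj₂ (linkageFromW-trivial b∈D′ (∈D′ s∈D s≢t))
      ... | no s≢w   | no t≢w with nbrAvoiding b
      ...   | r , nbr≢b =
        Sum.map (linkageFromW r) (linkageFromW r) (links (nbr∈D′ r) b∈D′ (∈D′ s∈D s≢w) (∈D′ t∈D t≢w) nbr≢b s≢t)

      links-D : ∀ {a b s t} → a ∈ D → b ∈ D → s ∈ D → t ∈ D → a ≢ b → s ≢ t → Link D a b s t
      links-D {a} {b} {s} {t} a∈D b∈D s∈D t∈D a≢b s≢t with a ≟ w | b ≟ w | s ≟ w | t ≟ w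
      ... | yes refl | _        | _        | _        = linkFromW (∈D′ b∈D (a≢b ∘ sym)) s∈D t∈D s≢t
      ... | no a≢w   | yes refl | _        | _        = swapLink (linkFromW (∈D′ a∈D a≢b) s∈D t∈D s≢t)
      ... | no _     | no _     | yes refl | _        = reverseLink (linkFromW (∈D′ t∈D (s≢t ∘ sym)) a∈D b∈D a≢b)
      ... | no _     | no _     | no _     | yes refl = swapTargets (reverseLink (linkFromW (∈D′ s∈D s≢t) a∈D b∈D a≢b))
      ... | no a≢w   | no b≢w   | no s≢w   | no t≢w   =
        weakenLink D′⊆D (links (∈D′ a∈D a≢w) (∈D′ b∈D b≢w) (∈D′ s∈D s≢w) (∈D′ t∈D t≢w) a≢b s≢t)

      fans-D : ∀ {v a b} → v ∈ D → a ∈ D → b ∈ D → v ≢ a → v ≢ b → a ≢ b → Fan D v a b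
      fans-D {v} {a} {b} v∈D a∈D b∈D v≢a v≢b a≢b with v ≟ w | a ≟ w | b ≟ w
      ... | yes refl | _        | _        = fanFromW (∈D′ a∈D (v≢a ∘ sym)) (∈D′ b∈D (v≢b ∘ sym)) a≢b
      ... | no v≢w   | yes refl | _        = fanToW (∈D′ v∈D v≢w) (∈D′ b∈D (a≢b ∘ sym)) v≢b
      ... | no v≢w   | no _     | yes refl = swapFan (fanToW (∈D′ v∈D v≢w) (∈D′ a∈D a≢b) v≢a)
      ... | no v≢w   | no a≢w   | no b≢w   =
        weakenFan D′⊆D (fans (∈D′ v∈D v≢w) (∈D′ a∈D a≢w) (∈D′ b∈D b≢w) v≢a v≢b a≢b)

      pathPairs-D : ∀ {u v} → u ∈ D → v ∈ D → u ≢ v → ¬ Joins G e₁ u v → TwoPaths D u v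
      pathPairs-D {u} {v} u∈D v∈D u≢v ¬j with u ≟ w | v ≟ w
      ... | yes refl | _        = twoPathsFromW (∈D′ v∈D (u≢v ∘ sym))
      ... | no _     | yes refl = reverseTwoPaths (twoPathsFromW (∈D′ u∈D u≢v))
      ... | no u≢w   | no v≢w   = weakenTwoPaths D′⊆D (pathPairs (∈D′ u∈D u≢w) (∈D′ v∈D v≢w) u≢v ¬j)

      linked-D : Linked D
      linked-D = record { links = links-D ; fans = fans-D ; pathPairs = pathPairs-D }

  linked : ∀ {D} → Closed D → Linked D
  linked {D} = go (suc (length D)) ≤-refl
    where
    go : ∀ fuel {D} → length D < fuel → Closed D → Linked D
    go (suc fuel) {D} bound closed with any? inner? D
    ... | no none   = linked-¬Inner λ q∈D inner → none (lose q∈D inner)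
    ... | yes found with find found
    ...   | _ , w₀∈D , inner₀ with findSource w₀∈D inner₀
    ...     | _ , w∈D , inner , noArc = linked-D (go fuel (≤-trans shorter (≤-pred bound)) closed′)
      where open RemoveSource closed w∈D inner noArc (outEdges inner) using (linked-D; shorter; closed′)

  pathPairsInG : ∀ {u v} → u ≢ v → ¬ Joins G e₁ u v → TwoPaths (allFin _) u v
  pathPairsInG = Linked.pathPairs (linked (λ _ _ → ∈-allFin _)) (∈-allFin _) (∈-allFin _)

-- The hypotheses m ≡ 2n - 3 and Connected G are unused: the edge count is forced by the colour
-- class sizes, and connectivity follows from the orientation described above.
lemma5 : (n m : ℕ) → 3 ≤ n → m ≡ 2 * n ∸ 3 →
    (G : Graph n m) → Connected G →
    (c : Fin m → Fin (n ∸ 1)) →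
    (∀ i → toℕ i ≡ 0 → colourCount c i ≡ 1) →
    (∀ i → toℕ i ≢ 0 → colourCount c i ≡ 2) →
    NoRainbowCycle G c →
    (u v : Fin n) →
    (∀ e₁ → toℕ (c e₁) ≡ 0 → ¬ Joins G e₁ u v) →
    Σ (List (Fin m)) λ es₁ → Σ (List (Fin m)) λ es₂ →
    Σ (Walk G u v es₁) λ P₁ → Σ (Walk G u v es₂) λ P₂ →
      IsPath G P₁ × IsPath G P₂ × Rainbow c es₁ × Rainbow c es₂ ×
      EdgeDisjoint es₁ es₂ × length es₁ + length es₂ ≤ n
lemma5 (suc zero)       _ (s≤s ())       _ _ _ _ _ _ _ _ _ _
lemma5 (suc (suc zero)) _ (s≤s (s≤s ())) _ _ _ _ _ _ _ _ _ _
lemma5 (suc (suc (suc _))) m _ _ G _ c zero-once others-twice noRainbowCycle u v notColourZero with u ≟ v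
... | yes refl = [] , [] , [] , [] , [] ∷ [] , [] ∷ [] , [] , [] , (λ _ ()) , z≤n
... | no u≢v   =
  edges P , edges Q , walk P , walk Q , isPath P , isPath Q , rainbow P , rainbow Q , edgeDisjoint ,
  internallyDisjoint⇒length≤ (walk P) (walk Q) (isPath P) (isPath Q) meet
  where
  open Walks G using (internallyDisjoint⇒length≤)
  colourZeroEdge : ∃ λ e → c e ≡ zero
  colourZeroEdge = colourCount≢0⇒coloured c zero (subst (_≢ 0) (sym (zero-once zero refl)) λ ())
  e₁ : Fin m
  e₁ = proj₁ colourZeroEdge
  open Colouring G c e₁ (proj₂ colourZeroEdge) (λ i i≢0 → ≤-reflexive (sym (others-twice i (i≢0 ∘ toℕ-injective))))
                 noRainbowCycle
  open TwoPaths (pathPairsInG u≢v (notColourZero e₁ (cong toℕ (proj₂ colourZeroEdge)))) renaming (first to P; second to Q)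
  open RainbowPath
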